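{- Let $n$ be a positive integer. Then $\tau(n+1)\equiv R_{25}(n)\pmod 5$.
   Context: $\tau$ is Ramanujan's tau function: $q\prod_{m=1}^{\infty}(1-q^m)^{24}=\sum_{n\geq1}\tau(n)q^n$. $R_{25}(n)$ is the number of partitions of $n$ with no part divisible by $25$. -}

module Defs where

open import Data.Nat as ℕ using (ℕ; zero; suc; _∸_; _≤?_; _≡ᵇ_)
open import Data.Nat.Divisibility using (_∣?_)
open import Data.Integer as ℤ using (ℤ; +_; -_)
open import Data.List using (List; []; _∷_; [_]; _++_; map; foldr; upTo)
open import Data.Bool using (Bool; true; false; if_then_else_; not; _∧_)
open import Relation.Nullary.Decidable using (⌊_⌋; yes; no)

Series : Set
Series = ℕ → ℤ

_·_ : Series → Series → Series
(f · g) k = foldr ℤ._+_ (+ 0) (map (λ i → f i ℤ.* g (k ∸ i)) (upTo (suc k)))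

oneS : Series
oneS zero    = + 1
oneS (suc _) = + 0

_^S_ : Series → ℕ → Series
f ^S zero  = oneS
f ^S suc e = f · (f ^S e)

-- the series 1 - q^m   (used for m ≥ 1)
oneMinusQ : ℕ → Series
oneMinusQ m zero    = + 1
oneMinusQ m (suc k) = if suc k ≡ᵇ m then - (+ 1) else + 0

etaProd : ℕ → Series
etaProd zero    = oneS
etaProd (suc N) = etaProd N · (oneMinusQ (suc N) ^S 24)

-- Ramanujan's tau: coefficient of q^n in q ∏_{m≥1} (1-q^m)^24.
-- τ(n+1) is the coefficient of q^n in ∏_{m≥1}(1-q^m)^24; factors with m > n
-- do not affect that coefficient, so the finite product up to m = n suffices.
τ : ℕ → ℤ
τ zero    = + 0
τ (suc n) = etaProd n n

-- partsAux fuel k n : all partitions of n with all parts ≤ k, listed as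
-- non-increasing lists.  Each recursive call decreases k or n, so fuel
-- k + n + 1 is sufficient.
partsAux : ℕ → ℕ → ℕ → List (List ℕ)
partsAux _        _       zero    = [ [] ]
partsAux zero     _       (suc n) = []
partsAux (suc f)  zero    (suc n) = []
partsAux (suc f)  (suc k) (suc n) =
  partsAux f k (suc n) ++
  (if ⌊ suc k ≤? suc n ⌋
     then map (suc k ∷_) (partsAux f (suc k) (suc n ∸ suc k))
     else [])

partitions : ℕ → List (List ℕ)
partitions n = partsAux (suc (n ℕ.+ n)) n n

noPartDiv25 : List ℕ → Bool
noPartDiv25 []       = true
noPartDiv25 (a ∷ as) = not ⌊ 25 ∣? a ⌋ ∧ noPartDiv25 as

countB : {A : Set} → (A → Bool) → List A → ℕ
countB P []       = 0
countB P (x ∷ xs) = if P x then suc (countB P xs) else countB P xs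

R₂₅ : ℕ → ℕ
R₂₅ n = countB noPartDiv25 (partitions n)

open import Relation.Binary.PropositionalEquality using (_≡_; refl)
private
  t2 : τ 2 ≡ - (+ 24)
  t2 = refl
  t3 : τ 3 ≡ + 252
  t3 = refl
  p5 : countB (λ _ → true) (partitions 5) ≡ 7
  p5 = refl
  p10 : countB (λ _ → true) (partitions 10) ≡ 42
  p10 = refl
  r25 : R₂₅ 25 ≡ 1958 ∸ 1
  r25 = refl

-- Modulo 5, (1 - q^m)^25 ≡ 1 - q^(25m). Hence multiplying ∏_{m ≤ N} (1 - q^m)^24 by
-- ∏_{m ≤ N} (1 - q^m) gives ∏_{m ≤ N} (1 - q^(25m)) mod 5. Multiplying the generating function of
-- partitions into parts ≤ N, none divisible by 25, by the same product gives ∏_{m ≤ N, 25 ∣ m} (1 - q^m).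
-- Both right-hand sides agree up to degree N, and for m ≥ 1 the factor 1 - q^m can be cancelled from a
-- congruence between series truncated at degree N. So the two series are congruent mod 5 up to
-- degree N, and comparing the coefficients of q^N gives τ(N + 1) ≡ R₂₅(N).

module Submission where

open import Defs
open import Data.Nat using (ℕ; suc; _≥_)
open import Data.Integer using (+_; _-_)
open import Data.Integer.Divisibility using (_∣_)

open import Data.Nat as ℕ using (zero; _≤_; _<_; z≤n; s≤s; _∸_; _≡ᵇ_; _≤?_)
import Data.Nat.Properties as ℕ
import Data.Nat.Divisibility as ℕ
open import Data.Integer as ℤ using (ℤ; _+_; _*_; -_)
import Data.Integer.Properties as ℤ
import Data.Integer.Divisibility.Signed as Signed
open import Data.Integer.Divisibility.Signed using (divides; ∣m∣n⇒∣m+n; ∣m⇒∣-m; ∣m⇒∣m*n)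
open import Data.Integer.Tactic.RingSolver using (solve-∀)
open import Data.Bool using (Bool; true; false; if_then_else_; not; _∧_)
open import Data.List using (List; []; _∷_; _++_; foldr; map; applyUpTo; applyDownFrom; replicate; filter)
open import Data.List.Properties using (map-upTo; ++-identityʳ; filter-accept; filter-reject)
open import Data.List.Relation.Binary.Pointwise using (Pointwise; []; _∷_)
open import Function using (_∘_)
open import Level using (0ℓ)
open import Relation.Binary.Bundles using (Setoid)
open import Relation.Binary.PropositionalEquality
import Relation.Binary.Reasoning.Setoid as SetoidReasoning
open import Relation.Nullary using (¬_; yes; no; does)
open import Relation.Nullary.Decidable using (dec-true; dec-false; isYes≗does)

module ≗-Reasoning = SetoidReasoning (ℕ →-setoid ℤ)

-- Multiplication by q^m

shift : ℕ → Series → Series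
shift zero    f         = f
shift (suc m) f zero    = + 0
shift (suc m) f (suc k) = shift m f k

shift-cong : ∀ m {f g} → f ≗ g → shift m f ≗ shift m g
shift-cong zero    f≗g k       = f≗g k
shift-cong (suc m) f≗g zero    = refl
shift-cong (suc m) f≗g (suc k) = shift-cong m f≗g k

shift-shift : ∀ a b f → shift a (shift b f) ≗ shift (a ℕ.+ b) f
shift-shift zero    b f k       = refl
shift-shift (suc a) b f zero    = refl
shift-shift (suc a) b f (suc k) = shift-shift a b f k

shift-comm : ∀ a b f → shift a (shift b f) ≗ shift b (shift a f)
shift-comm a b f k = begin
  shift a (shift b f) k  ≡⟨ shift-shift a b f k ⟩
  shift (a ℕ.+ b) f k    ≡⟨ cong (λ c → shift c f k) (ℕ.+-comm a b) ⟩
  shift (b ℕ.+ a) f k    ≡⟨ shift-shift b a f k ⟨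
  shift b (shift a f) k  ∎
  where open ≡-Reasoning

shift-zipWith : ∀ (F : ℤ → ℤ → ℤ) → F (+ 0) (+ 0) ≡ + 0 → ∀ m f g →
                shift m (λ k → F (f k) (g k)) ≗ λ k → F (shift m f k) (shift m g k)
shift-zipWith F F00 zero    f g k       = refl
shift-zipWith F F00 (suc m) f g zero    = sym F00
shift-zipWith F F00 (suc m) f g (suc k) = shift-zipWith F F00 m f g k

shift-const-0 : ∀ m k → shift m (λ _ → + 0) k ≡ + 0
shift-const-0 zero    k       = refl
shift-const-0 (suc m) zero    = refl
shift-const-0 (suc m) (suc k) = shift-const-0 m k

shift-≥ : ∀ m f {k} → m ≤ k → shift m f k ≡ f (k ∸ m)
shift-≥ zero    f _         = refl
shift-≥ (suc m) f (s≤s m≤k) = shift-≥ m f m≤k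

shift-< : ∀ m f {k} → k < m → shift m f k ≡ + 0
shift-< (suc m) f {zero}  _         = refl
shift-< (suc m) f {suc k} (s≤s k<m) = shift-< m f k<m

shift-oneS : ∀ m k → shift m oneS k ≡ (if k ≡ᵇ m then + 1 else + 0)
shift-oneS zero    zero    = refl
shift-oneS zero    (suc k) = refl
shift-oneS (suc m) zero    = refl
shift-oneS (suc m) (suc k) = shift-oneS m k

sumUpTo : (ℕ → ℤ) → ℕ → ℤ
sumUpTo F n = foldr _+_ (+ 0) (applyUpTo F n)

sumUpTo-suc : ∀ F n → sumUpTo F (suc n) ≡ sumUpTo F n + F n
sumUpTo-suc F zero    = trans (ℤ.+-identityʳ (F 0)) (sym (ℤ.+-identityˡ (F 0)))
sumUpTo-suc F (suc n) = trans (cong (λ x → F 0 + x) (sumUpTo-suc (F ∘ suc) n))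
                              (sym (ℤ.+-assoc (F 0) _ _))

sumUpTo-cong : ∀ {F G} n → (∀ {i} → i < n → F i ≡ G i) → sumUpTo F n ≡ sumUpTo G n
sumUpTo-cong zero    F≡G = refl
sumUpTo-cong (suc n) F≡G = cong₂ _+_ (F≡G (s≤s z≤n)) (sumUpTo-cong n (F≡G ∘ s≤s))

sumUpTo-zero : ∀ {F} n → (∀ {i} → i < n → F i ≡ + 0) → sumUpTo F n ≡ + 0
sumUpTo-zero zero    F≡0 = refl
sumUpTo-zero (suc n) F≡0 = cong₂ _+_ (F≡0 (s≤s z≤n)) (sumUpTo-zero n (F≡0 ∘ s≤s))

sumUpTo-- : ∀ F G n → sumUpTo (λ i → F i - G i) n ≡ sumUpTo F n - sumUpTo G n
sumUpTo-- F G zero    = refl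
sumUpTo-- F G (suc n) = trans (cong (λ x → (F 0 - G 0) + x) (sumUpTo-- (F ∘ suc) (G ∘ suc) n))
                              (interchange (F 0) (G 0) _ _)
  where
  interchange : ∀ a b c d → (a - b) + (c - d) ≡ (a + c) - (b + d)
  interchange = solve-∀

·-as-sum : ∀ f g k → (f · g) k ≡ sumUpTo (λ i → f i * g (k ∸ i)) (suc k)
·-as-sum f g k = cong (foldr _+_ (+ 0)) (map-upTo (λ i → f i * g (k ∸ i)) (suc k))

·-congˡ : ∀ f {g h} → g ≗ h → f · g ≗ f · h
·-congˡ f {g} {h} g≗h k = begin
  (f · g) k                                   ≡⟨ ·-as-sum f g k ⟩
  sumUpTo (λ i → f i * g (k ∸ i)) (suc k)     ≡⟨ sumUpTo-cong (suc k) (λ {i} _ → cong (f i *_) (g≗h (k ∸ i))) ⟩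
  sumUpTo (λ i → f i * h (k ∸ i)) (suc k)     ≡⟨ ·-as-sum f h k ⟨
  (f · h) k                                   ∎
  where open ≡-Reasoning

·-identityʳ : ∀ f → f · oneS ≗ f
·-identityʳ f k = begin
  (f · oneS) k                                                    ≡⟨ ·-as-sum f oneS k ⟩
  sumUpTo (λ i → f i * oneS (k ∸ i)) (suc k)                      ≡⟨ sumUpTo-suc (λ i → f i * oneS (k ∸ i)) k ⟩
  sumUpTo (λ i → f i * oneS (k ∸ i)) k + f k * oneS (k ∸ k)       ≡⟨ cong₂ _+_ (sumUpTo-zero k off-diagonal)
                                                                               (cong (λ j → f k * oneS j) (ℕ.n∸n≡0 k)) ⟩
  + 0 + f k * + 1                                                 ≡⟨ ℤ.+-identityˡ _ ⟩
  f k * + 1                                                       ≡⟨ ℤ.*-identityʳ (f k) ⟩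
  f k                                                             ∎
  where
  open ≡-Reasoning
  off-diagonal : ∀ {i} → i < k → f i * oneS (k ∸ i) ≡ + 0
  off-diagonal {i} (s≤s i≤k′) rewrite ℕ.+-∸-assoc 1 i≤k′ = ℤ.*-zeroʳ (f i)

·-distribˡ-- : ∀ f g h → f · (λ k → g k - h k) ≗ λ k → (f · g) k - (f · h) k
·-distribˡ-- f g h k = begin
    (f · (λ j → g j - h j)) k
  ≡⟨ ·-as-sum f (λ j → g j - h j) k ⟩
    sumUpTo (λ i → f i * (g (k ∸ i) - h (k ∸ i))) (suc k)
  ≡⟨ sumUpTo-cong (suc k) (λ {i} _ → *-distribˡ-- (f i) (g (k ∸ i)) (h (k ∸ i))) ⟩
    sumUpTo (λ i → f i * g (k ∸ i) - f i * h (k ∸ i)) (suc k)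
  ≡⟨ sumUpTo-- (λ i → f i * g (k ∸ i)) (λ i → f i * h (k ∸ i)) (suc k) ⟩
    sumUpTo (λ i → f i * g (k ∸ i)) (suc k) - sumUpTo (λ i → f i * h (k ∸ i)) (suc k)
  ≡⟨ cong₂ _-_ (·-as-sum f g k) (·-as-sum f h k) ⟨
    (f · g) k - (f · h) k
  ∎
  where
  open ≡-Reasoning
  *-distribˡ-- : ∀ x y z → x * (y - z) ≡ x * y - x * z
  *-distribˡ-- = solve-∀

·-shift1 : ∀ f g → f · shift 1 g ≗ shift 1 (f · g)
·-shift1 f g zero    = trans (ℤ.+-identityʳ _) (ℤ.*-zeroʳ (f 0))
·-shift1 f g (suc k) = begin
    (f · shift 1 g) (suc k)
  ≡⟨ ·-as-sum f (shift 1 g) (suc k) ⟩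
    sumUpTo (λ i → f i * shift 1 g (suc k ∸ i)) (suc (suc k))
  ≡⟨ sumUpTo-suc (λ i → f i * shift 1 g (suc k ∸ i)) (suc k) ⟩
    sumUpTo (λ i → f i * shift 1 g (suc k ∸ i)) (suc k) + f (suc k) * shift 1 g (k ∸ k)
  ≡⟨ cong₂ _+_ (sumUpTo-cong (suc k) shifted) last-vanishes ⟩
    sumUpTo (λ i → f i * g (k ∸ i)) (suc k) + + 0
  ≡⟨ ℤ.+-identityʳ _ ⟩
    sumUpTo (λ i → f i * g (k ∸ i)) (suc k)
  ≡⟨ ·-as-sum f g k ⟨
    (f · g) k
  ∎
  where
  open ≡-Reasoning
  shifted : ∀ {i} → i < suc k → f i * shift 1 g (suc k ∸ i) ≡ f i * g (k ∸ i)
  shifted {i} (s≤s i≤k) rewrite ℕ.+-∸-assoc 1 i≤k = refl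
  last-vanishes : f (suc k) * shift 1 g (k ∸ k) ≡ + 0
  last-vanishes rewrite ℕ.n∸n≡0 k = ℤ.*-zeroʳ (f (suc k))

·-shift : ∀ m f g → f · shift m g ≗ shift m (f · g)
·-shift zero    f g = λ _ → refl
·-shift (suc m) f g = begin
  f · shift (suc m) g         ≈⟨ ·-congˡ f (shift-shift 1 m g) ⟨
  f · shift 1 (shift m g)     ≈⟨ ·-shift1 f (shift m g) ⟩
  shift 1 (f · shift m g)     ≈⟨ shift-cong 1 (·-shift m f g) ⟩
  shift 1 (shift m (f · g))   ≈⟨ shift-shift 1 m (f · g) ⟩
  shift (suc m) (f · g)       ∎
  where open ≗-Reasoning

-- poly cs m f = Σᵢ csᵢ qⁱᵐ f
poly : List ℤ → ℕ → Series → Series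
poly []       m f k = + 0
poly (c ∷ cs) m f k = c * f k + poly cs m (shift m f) k

shift-poly : ∀ cs m f → shift m (poly cs m f) ≗ poly cs m (shift m f)
shift-poly []       m f k = shift-const-0 m k
shift-poly (c ∷ cs) m f k = begin
    shift m (λ j → c * f j + poly cs m (shift m f) j) k
  ≡⟨ shift-zipWith (λ x y → c * x + y) (trans (ℤ.+-identityʳ _) (ℤ.*-zeroʳ c)) m f _ k ⟩
    c * shift m f k + shift m (poly cs m (shift m f)) k
  ≡⟨ cong (λ x → c * shift m f k + x) (shift-poly cs m (shift m f) k) ⟩
    c * shift m f k + poly cs m (shift m (shift m f)) k
  ∎
  where open ≡-Reasoning

-- oneMinusX d cs lists the coefficients of (1 - x) p - d, where p = Σᵢ csᵢ xⁱ.
oneMinusX : ℤ → List ℤ → List ℤ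
oneMinusX d []       = - d ∷ []
oneMinusX d (c ∷ cs) = (c - d) ∷ oneMinusX c cs

poly-oneMinusX : ∀ d cs m f k →
                 poly (oneMinusX d cs) m f k ≡ (poly cs m f k - d * f k) - poly cs m (shift m f) k
poly-oneMinusX d []       m f k = leading d (f k)
  where
  leading : ∀ d x → - d * x + + 0 ≡ (+ 0 - d * x) - + 0
  leading = solve-∀
poly-oneMinusX d (c ∷ cs) m f k = begin
    (c - d) * f k + poly (oneMinusX c cs) m (shift m f) k
  ≡⟨ cong (λ x → (c - d) * f k + x) (poly-oneMinusX c cs m (shift m f) k) ⟩
    (c - d) * f k + ((poly cs m (shift m f) k - c * shift m f k) - poly cs m (shift m (shift m f)) k)
  ≡⟨ regroup c d (f k) (shift m f k) (poly cs m (shift m f) k) (poly cs m (shift m (shift m f)) k) ⟩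
    ((c * f k + poly cs m (shift m f) k) - d * f k) - (c * shift m f k + poly cs m (shift m (shift m f)) k)
  ∎
  where
  open ≡-Reasoning
  regroup : ∀ c d x y p q → (c - d) * x + ((p - c * y) - q) ≡ ((c * x + p) - d * x) - (c * y + q)
  regroup = solve-∀

[1-x]^ : ℕ → List ℤ
[1-x]^ zero    = + 1 ∷ []
[1-x]^ (suc e) = oneMinusX (+ 0) ([1-x]^ e)

poly-monomial : ∀ j c m f k → poly (replicate j (+ 0) ++ c ∷ []) m f k ≡ c * shift (j ℕ.* m) f k
poly-monomial zero    c m f k = ℤ.+-identityʳ (c * f k)
poly-monomial (suc j) c m f k = begin
  + 0 + poly (replicate j (+ 0) ++ c ∷ []) m (shift m f) k  ≡⟨ ℤ.+-identityˡ _ ⟩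
  poly (replicate j (+ 0) ++ c ∷ []) m (shift m f) k        ≡⟨ poly-monomial j c m (shift m f) k ⟩
  c * shift (j ℕ.* m) (shift m f) k                         ≡⟨ cong (c *_) (shift-shift (j ℕ.* m) m f k) ⟩
  c * shift (j ℕ.* m ℕ.+ m) f k                             ≡⟨ cong (λ a → c * shift a f k) (ℕ.+-comm (j ℕ.* m) m) ⟩
  c * shift (suc j ℕ.* m) f k                               ∎
  where open ≡-Reasoning

-- Opaque because the products Π[1-q^ replicate 25 m ] below would otherwise unfold
-- into terms of exponential size.
opaque
  infixr 25 [1-q^_]_

  [1-q^_]_ : ℕ → Series → Series
  ([1-q^ m ] f) k = f k - shift m f k

  [1-q^]-cong : ∀ m {f g} → f ≗ g → [1-q^ m ] f ≗ [1-q^ m ] g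
  [1-q^]-cong m f≗g k = cong₂ _-_ (f≗g k) (shift-cong m f≗g k)

  [1-q^]-comm : ∀ a b f → [1-q^ a ] [1-q^ b ] f ≗ [1-q^ b ] [1-q^ a ] f
  [1-q^]-comm a b f k = begin
      (f k - shift b f k) - shift a ([1-q^ b ] f) k
    ≡⟨ cong (λ x → (f k - shift b f k) - x) (shift-zipWith _-_ refl a f (shift b f) k) ⟩
      (f k - shift b f k) - (shift a f k - shift a (shift b f) k)
    ≡⟨ cong (λ x → (f k - shift b f k) - (shift a f k - x)) (shift-comm a b f k) ⟩
      (f k - shift b f k) - (shift a f k - shift b (shift a f) k)
    ≡⟨ swap (f k) (shift b f k) (shift a f k) _ ⟩
      (f k - shift a f k) - (shift b f k - shift b (shift a f) k)
    ≡⟨ cong (λ x → (f k - shift a f k) - x) (shift-zipWith _-_ refl b f (shift a f) k) ⟨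
      (f k - shift a f k) - shift b ([1-q^ a ] f) k
    ∎
    where
    open ≡-Reasoning
    swap : ∀ x y z w → (x - y) - (z - w) ≡ (x - z) - (y - w)
    swap = solve-∀

  [1-q^]-inverse : ∀ m {f g} → (∀ k → g k ≡ f k + shift m g k) → [1-q^ m ] g ≗ f
  [1-q^]-inverse m {f} {g} g≡f+q^mg k =
    trans (cong (λ x → x - shift m g k) (g≡f+q^mg k)) (cancel (f k) (shift m g k))
    where
    cancel : ∀ x y → (x + y) - y ≡ x
    cancel = solve-∀

  ·-[1-q^] : ∀ m f g → f · [1-q^ m ] g ≗ [1-q^ m ] (f · g)
  ·-[1-q^] m f g k =
    trans (·-distribˡ-- f g (shift m g) k) (cong (λ x → (f · g) k - x) (·-shift m f g k))

  oneMinusQ-[1-q^] : ∀ m → oneMinusQ (suc m) ≗ [1-q^ suc m ] oneS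
  oneMinusQ-[1-q^] m zero    = refl
  oneMinusQ-[1-q^] m (suc k) =
    trans (negate-if (k ≡ᵇ m)) (cong (λ x → + 0 - x) (sym (shift-oneS m k)))
    where
    negate-if : ∀ b → (if b then - + 1 else + 0) ≡ + 0 - (if b then + 1 else + 0)
    negate-if true  = refl
    negate-if false = refl

  [1-q^]-poly : ∀ cs m f → [1-q^ m ] poly cs m f ≗ poly (oneMinusX (+ 0) cs) m f
  [1-q^]-poly cs m f k = begin
    poly cs m f k - shift m (poly cs m f) k           ≡⟨ cong (λ x → poly cs m f k - x) (shift-poly cs m f k) ⟩
    poly cs m f k - poly cs m (shift m f) k           ≡⟨ cong (λ x → x - poly cs m (shift m f) k) (ℤ.+-identityʳ (poly cs m f k)) ⟨
    (poly cs m f k - + 0) - poly cs m (shift m f) k   ≡⟨ poly-oneMinusX (+ 0) cs m f k ⟨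
    poly (oneMinusX (+ 0) cs) m f k                   ∎
    where open ≡-Reasoning

  poly-[1-q^5*] : ∀ m f → poly (+ 1 ∷ replicate 4 (+ 0) ++ - + 1 ∷ []) m f ≗ [1-q^ 5 ℕ.* m ] f
  poly-[1-q^5*] m f k = begin
    + 1 * f k + tail                            ≡⟨ cong (λ x → + 1 * f k + x) (ℤ.+-identityˡ tail) ⟨
    + 1 * f k + (+ 0 + tail)                    ≡⟨ cong (λ x → + 1 * f k + x) (poly-monomial 5 (- + 1) m f k) ⟩
    + 1 * f k + - + 1 * shift (5 ℕ.* m) f k     ≡⟨ difference (f k) (shift (5 ℕ.* m) f k) ⟩
    f k - shift (5 ℕ.* m) f k                   ∎
    where
    open ≡-Reasoning
    tail : ℤ
    tail = poly (replicate 4 (+ 0) ++ - + 1 ∷ []) m (shift m f) k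
    difference : ∀ x y → + 1 * x + - + 1 * y ≡ x - y
    difference = solve-∀

infixr 25 Π[1-q^_]_

Π[1-q^_]_ : List ℕ → Series → Series
Π[1-q^ []     ] f = f
Π[1-q^ m ∷ ms ] f = [1-q^ m ] Π[1-q^ ms ] f

oneTo : ℕ → List ℕ
oneTo = applyDownFrom suc

Π[1-q^]-cong : ∀ ms {f g} → f ≗ g → Π[1-q^ ms ] f ≗ Π[1-q^ ms ] g
Π[1-q^]-cong []       f≗g = f≗g
Π[1-q^]-cong (m ∷ ms) f≗g = [1-q^]-cong m (Π[1-q^]-cong ms f≗g)

Π[1-q^]-[1-q^] : ∀ ms m f → Π[1-q^ ms ] [1-q^ m ] f ≗ [1-q^ m ] Π[1-q^ ms ] f
Π[1-q^]-[1-q^] []        m f = λ _ → refl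
Π[1-q^]-[1-q^] (m′ ∷ ms) m f = begin
  [1-q^ m′ ] Π[1-q^ ms ] [1-q^ m ] f    ≈⟨ [1-q^]-cong m′ (Π[1-q^]-[1-q^] ms m f) ⟩
  [1-q^ m′ ] [1-q^ m ] Π[1-q^ ms ] f    ≈⟨ [1-q^]-comm m′ m (Π[1-q^ ms ] f) ⟩
  [1-q^ m ] [1-q^ m′ ] Π[1-q^ ms ] f    ∎
  where open ≗-Reasoning

Π[1-q^]-comm : ∀ ms ns f → Π[1-q^ ms ] Π[1-q^ ns ] f ≗ Π[1-q^ ns ] Π[1-q^ ms ] f
Π[1-q^]-comm ms []       f = λ _ → refl
Π[1-q^]-comm ms (n ∷ ns) f = begin
  Π[1-q^ ms ] [1-q^ n ] Π[1-q^ ns ] f   ≈⟨ Π[1-q^]-[1-q^] ms n (Π[1-q^ ns ] f) ⟩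
  [1-q^ n ] Π[1-q^ ms ] Π[1-q^ ns ] f   ≈⟨ [1-q^]-cong n (Π[1-q^]-comm ms ns f) ⟩
  [1-q^ n ] Π[1-q^ ns ] Π[1-q^ ms ] f   ∎
  where open ≗-Reasoning

·-Π[1-q^] : ∀ ms f g → f · Π[1-q^ ms ] g ≗ Π[1-q^ ms ] (f · g)
·-Π[1-q^] []       f g = λ _ → refl
·-Π[1-q^] (m ∷ ms) f g = begin
  f · [1-q^ m ] Π[1-q^ ms ] g       ≈⟨ ·-[1-q^] m f (Π[1-q^ ms ] g) ⟩
  [1-q^ m ] (f · Π[1-q^ ms ] g)     ≈⟨ [1-q^]-cong m (·-Π[1-q^] ms f g) ⟩
  [1-q^ m ] Π[1-q^ ms ] (f · g)     ∎
  where open ≗-Reasoning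

Π[1-q^]-replicate : ∀ e m f → Π[1-q^ replicate e m ] f ≗ poly ([1-x]^ e) m f
Π[1-q^]-replicate zero    m f k = sym (trans (ℤ.+-identityʳ _) (ℤ.*-identityˡ (f k)))
Π[1-q^]-replicate (suc e) m f = begin
  [1-q^ m ] Π[1-q^ replicate e m ] f   ≈⟨ [1-q^]-cong m (Π[1-q^]-replicate e m f) ⟩
  [1-q^ m ] poly ([1-x]^ e) m f        ≈⟨ [1-q^]-poly ([1-x]^ e) m f ⟩
  poly ([1-x]^ (suc e)) m f            ∎
  where open ≗-Reasoning

oneMinusQ^-Π : ∀ e m → oneMinusQ (suc m) ^S e ≗ Π[1-q^ replicate e (suc m) ] oneS
oneMinusQ^-Π zero    m = λ _ → refl
oneMinusQ^-Π (suc e) m = begin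
  q · (q ^S e)                    ≈⟨ ·-congˡ q (oneMinusQ^-Π e m) ⟩
  q · Π[1-q^ ms ] oneS            ≈⟨ ·-Π[1-q^] ms q oneS ⟩
  Π[1-q^ ms ] (q · oneS)          ≈⟨ Π[1-q^]-cong ms (·-identityʳ q) ⟩
  Π[1-q^ ms ] q                   ≈⟨ Π[1-q^]-cong ms (oneMinusQ-[1-q^] m) ⟩
  Π[1-q^ ms ] [1-q^ suc m ] oneS  ≈⟨ Π[1-q^]-[1-q^] ms (suc m) oneS ⟩
  [1-q^ suc m ] Π[1-q^ ms ] oneS  ∎
  where
  open ≗-Reasoning
  q  = oneMinusQ (suc m)
  ms = replicate e (suc m)

etaProd-suc : ∀ N → etaProd (suc N) ≗ Π[1-q^ replicate 24 (suc N) ] etaProd N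
etaProd-suc N = begin
  etaProd N · (oneMinusQ (suc N) ^S 24) ≈⟨ ·-congˡ (etaProd N) (oneMinusQ^-Π 24 N) ⟩
  etaProd N · Π[1-q^ ms ] oneS          ≈⟨ ·-Π[1-q^] ms (etaProd N) oneS ⟩
  Π[1-q^ ms ] (etaProd N · oneS)        ≈⟨ Π[1-q^]-cong ms (·-identityʳ (etaProd N)) ⟩
  Π[1-q^ ms ] etaProd N                 ∎
  where
  open ≗-Reasoning
  ms = replicate 24 (suc N)

infix 4 _≡_[mod_]

-- A record rather than a synonym for d ∣ a - b, so that a and b can be inferred.
record _≡_[mod_] (a b d : ℤ) : Set where
  constructor ≡[mod]
  field d∣a-b : d Signed.∣ a - b

module _ {d : ℤ} where

  ≡⇒≡[mod] : ∀ {a b} → a ≡ b → a ≡ b [mod d ]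
  ≡⇒≡[mod] {b = b} refl = ≡[mod] (divides (+ 0) (ℤ.+-inverseʳ b))

  [mod]-refl : ∀ {a} → a ≡ a [mod d ]
  [mod]-refl = ≡⇒≡[mod] refl

  [mod]-sym : ∀ {a b} → a ≡ b [mod d ] → b ≡ a [mod d ]
  [mod]-sym {a} {b} (≡[mod] d∣a-b) = ≡[mod] (subst (d Signed.∣_) (negate a b) (∣m⇒∣-m d∣a-b))
    where
    negate : ∀ a b → - (a - b) ≡ b - a
    negate = solve-∀

  [mod]-trans : ∀ {a b c} → a ≡ b [mod d ] → b ≡ c [mod d ] → a ≡ c [mod d ]
  [mod]-trans {a} {b} {c} (≡[mod] d∣a-b) (≡[mod] d∣b-c) =
    ≡[mod] (subst (d Signed.∣_) (telescope a b c) (∣m∣n⇒∣m+n d∣a-b d∣b-c))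
    where
    telescope : ∀ a b c → (a - b) + (b - c) ≡ a - c
    telescope = solve-∀

  +-cong[mod] : ∀ {a b c e} → a ≡ b [mod d ] → c ≡ e [mod d ] → a + c ≡ b + e [mod d ]
  +-cong[mod] {a} {b} {c} {e} (≡[mod] d∣a-b) (≡[mod] d∣c-e) =
    ≡[mod] (subst (d Signed.∣_) (interchange a b c e) (∣m∣n⇒∣m+n d∣a-b d∣c-e))
    where
    interchange : ∀ a b c e → (a - b) + (c - e) ≡ (a + c) - (b + e)
    interchange = solve-∀

  -‿cong[mod] : ∀ {a b} → a ≡ b [mod d ] → - a ≡ - b [mod d ]
  -‿cong[mod] {a} {b} (≡[mod] d∣a-b) = ≡[mod] (subst (d Signed.∣_) (negate a b) (∣m⇒∣-m d∣a-b))
    where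
    negate : ∀ a b → - (a - b) ≡ - a - - b
    negate = solve-∀

  *-congʳ[mod] : ∀ c {a b} → a ≡ b [mod d ] → a * c ≡ b * c [mod d ]
  *-congʳ[mod] c {a} {b} (≡[mod] d∣a-b) = ≡[mod] (subst (d Signed.∣_) (distrib a b c) (∣m⇒∣m*n c d∣a-b))
    where
    distrib : ∀ a b c → (a - b) * c ≡ a * c - b * c
    distrib = solve-∀

module ModularSeries (d : ℤ) where

  infix 4 _≈[_]_

  _≈[_]_ : Series → ℕ → Series → Set
  f ≈[ n ] g = ∀ {k} → k ≤ n → f k ≡ g k [mod d ]

  ≈-setoid : ℕ → Setoid 0ℓ 0ℓ
  ≈-setoid n = record
    { Carrier       = Series
    ; _≈_           = _≈[ n ]_
    ; isEquivalence = record
      { refl  = λ _ → [mod]-refl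
      ; sym   = λ f≈g k≤n → [mod]-sym (f≈g k≤n)
      ; trans = λ f≈g g≈h k≤n → [mod]-trans (f≈g k≤n) (g≈h k≤n)
      }
    }

  module ≈-Reasoning (n : ℕ) = SetoidReasoning (≈-setoid n)

  ≗⇒≈ : ∀ {n f g} → f ≗ g → f ≈[ n ] g
  ≗⇒≈ f≗g _ = ≡⇒≡[mod] (f≗g _)

  shift-resp-≈ : ∀ m {n f g} → f ≈[ n ] g → shift m f ≈[ n ] shift m g
  shift-resp-≈ zero    f≈g               = f≈g
  shift-resp-≈ (suc m) f≈g {zero}  _     = [mod]-refl
  shift-resp-≈ (suc m) f≈g {suc k} 1+k≤n = shift-resp-≈ m f≈g (ℕ.<⇒≤ 1+k≤n)

  shift-suc-resp-≈ : ∀ m {n f g} → f ≈[ n ] g → shift (suc m) f ≈[ suc n ] shift (suc m) g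
  shift-suc-resp-≈ m f≈g {zero}  _         = [mod]-refl
  shift-suc-resp-≈ m f≈g {suc k} (s≤s k≤n) = shift-resp-≈ m f≈g k≤n

  poly-resp : ∀ m f {cs ds n} → Pointwise _≡_[mod d ] cs ds → poly cs m f ≈[ n ] poly ds m f
  poly-resp m f []             _   = [mod]-refl
  poly-resp m f (c≡d ∷ cs≡ds) k≤n =
    +-cong[mod] (*-congʳ[mod] (f _) c≡d) (poly-resp m (shift m f) cs≡ds k≤n)

  opaque
    unfolding [1-q^_]_

    [1-q^]-resp-≈ : ∀ m {n f g} → f ≈[ n ] g → [1-q^ m ] f ≈[ n ] [1-q^ m ] g
    [1-q^]-resp-≈ m f≈g k≤n = +-cong[mod] (f≈g k≤n) (-‿cong[mod] (shift-resp-≈ m f≈g k≤n))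

    [1-q^]-large : ∀ m {n f} → n < m → [1-q^ m ] f ≈[ n ] f
    [1-q^]-large m {f = f} n<m {k} k≤n = ≡⇒≡[mod] (begin
      f k - shift m f k   ≡⟨ cong (λ x → f k - x) (shift-< m f (ℕ.≤-<-trans k≤n n<m)) ⟩
      f k - + 0           ≡⟨ ℤ.+-identityʳ (f k) ⟩
      f k                 ∎)
      where open ≡-Reasoning

    ≈-from-[1-q^] : ∀ m {n f g} → [1-q^ m ] f ≈[ n ] [1-q^ m ] g → shift m f ≈[ n ] shift m g →
                    f ≈[ n ] g
    ≈-from-[1-q^] m {f = f} {g} product≈ shift≈ {k} k≤n =
      subst₂ _≡_[mod d ] (restore (f k) (shift m f k)) (restore (g k) (shift m g k))
             (+-cong[mod] (product≈ k≤n) (shift≈ k≤n))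
      where
      restore : ∀ x y → (x - y) + y ≡ x
      restore = solve-∀

  -- Induction on the degree: the coefficient of qⁿ in f is that of (1 - q^(m+1)) f plus
  -- a coefficient of f of degree below n.
  [1-q^]-cancel : ∀ m n {f g} → [1-q^ suc m ] f ≈[ n ] [1-q^ suc m ] g → f ≈[ n ] g
  [1-q^]-cancel m zero    product≈ = ≈-from-[1-q^] (suc m) product≈ λ { z≤n → [mod]-refl }
  [1-q^]-cancel m (suc n) product≈ = ≈-from-[1-q^] (suc m) product≈
    (shift-suc-resp-≈ m ([1-q^]-cancel m n (λ k≤n → product≈ (ℕ.m≤n⇒m≤1+n k≤n))))

  Π[1-q^]-oneTo-cancel : ∀ N {n f g} → Π[1-q^ oneTo N ] f ≈[ n ] Π[1-q^ oneTo N ] g → f ≈[ n ] g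
  Π[1-q^]-oneTo-cancel zero        Π≈ = Π≈
  Π[1-q^]-oneTo-cancel (suc N) {n} Π≈ = Π[1-q^]-oneTo-cancel N ([1-q^]-cancel N n Π≈)

open ModularSeries (+ 5)

-- The Frobenius congruence (1 - q^m)^25 ≡ 1 - q^(25m) mod 5

Π[1-q^]-replicate-5 : ∀ m f {n} → Π[1-q^ replicate 5 m ] f ≈[ n ] [1-q^ 5 ℕ.* m ] f
Π[1-q^]-replicate-5 m f {n} = begin
  Π[1-q^ replicate 5 m ] f                          ≈⟨ ≗⇒≈ (Π[1-q^]-replicate 5 m f) ⟩
  poly ([1-x]^ 5) m f                               ≈⟨ poly-resp m f binomial≡ ⟩
  poly (+ 1 ∷ replicate 4 (+ 0) ++ - + 1 ∷ []) m f  ≈⟨ ≗⇒≈ (poly-[1-q^5*] m f) ⟩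
  [1-q^ 5 ℕ.* m ] f                                 ∎
  where
  open ≈-Reasoning n
  binomial≡ : Pointwise _≡_[mod + 5 ] ([1-x]^ 5) (+ 1 ∷ replicate 4 (+ 0) ++ - + 1 ∷ [])
  binomial≡ = [mod]-refl ∷ ≡[mod] (divides (- + 1) refl) ∷ ≡[mod] (divides (+ 2) refl)
            ∷ ≡[mod] (divides (- + 2) refl) ∷ ≡[mod] (divides (+ 1) refl) ∷ [mod]-refl ∷ []

Π[1-q^]-replicate-*5 : ∀ j m f {n} → Π[1-q^ replicate (j ℕ.* 5) m ] f ≈[ n ] Π[1-q^ replicate j (5 ℕ.* m) ] f
Π[1-q^]-replicate-*5 zero    m f     = λ _ → [mod]-refl
Π[1-q^]-replicate-*5 (suc j) m f {n} = begin
  Π[1-q^ replicate 5 m ] Π[1-q^ replicate (j ℕ.* 5) m ] f  ≈⟨ Π[1-q^]-replicate-5 m (Π[1-q^ replicate (j ℕ.* 5) m ] f) ⟩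
  [1-q^ 5 ℕ.* m ] Π[1-q^ replicate (j ℕ.* 5) m ] f         ≈⟨ [1-q^]-resp-≈ (5 ℕ.* m) (Π[1-q^]-replicate-*5 j m f) ⟩
  [1-q^ 5 ℕ.* m ] Π[1-q^ replicate j (5 ℕ.* m) ] f         ∎
  where open ≈-Reasoning n

Π[1-q^]-replicate-25 : ∀ m f {n} → Π[1-q^ replicate 25 m ] f ≈[ n ] [1-q^ m ℕ.* 25 ] f
Π[1-q^]-replicate-25 m f {n} = begin
  Π[1-q^ replicate (5 ℕ.* 5) m ] f   ≈⟨ Π[1-q^]-replicate-*5 5 m f ⟩
  Π[1-q^ replicate 5 (5 ℕ.* m) ] f   ≈⟨ Π[1-q^]-replicate-5 (5 ℕ.* m) f ⟩
  [1-q^ 5 ℕ.* (5 ℕ.* m) ] f          ≡⟨ cong (λ a → [1-q^ a ] f) (trans (sym (ℕ.*-assoc 5 5 m)) (ℕ.*-comm 25 m)) ⟩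
  [1-q^ m ℕ.* 25 ] f                 ∎
  where open ≈-Reasoning n

-- Partitions with no part divisible by 25

partsBounded : ℕ → ℕ → List (List ℕ)
partsBounded k m = partsAux (suc (k ℕ.+ m)) k m

R₂₅[≤_] : ℕ → Series
R₂₅[≤ k ] m = + countB noPartDiv25 (partsBounded k m)

partsAux-fuel : ∀ {f f′} k m → k ℕ.+ m < f → k ℕ.+ m < f′ → partsAux f k m ≡ partsAux f′ k m
partsAux-fuel                 k       zero    _        _         = refl
partsAux-fuel {suc f} {suc f′} zero    (suc m) _        _         = refl
partsAux-fuel {suc f} {suc f′} (suc k) (suc m) (s≤s lt) (s≤s lt′) with suc k ≤? suc m
... | yes (s≤s k≤m) = cong₂ _++_ (partsAux-fuel k (suc m) lt lt′)
                                 (cong (map (suc k ∷_)) (partsAux-fuel (suc k) (m ∸ k) (bound lt) (bound lt′)))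
  where
  bound : ∀ {f} → k ℕ.+ suc m < f → suc k ℕ.+ (m ∸ k) < f
  bound = ℕ.≤-<-trans (ℕ.≤-trans (ℕ.≤-reflexive (cong suc (ℕ.m+[n∸m]≡n k≤m))) (ℕ.m≤n+m (suc m) k))
... | no _          = cong (_++ []) (partsAux-fuel k (suc m) lt lt′)

countB-++ : ∀ {A : Set} (p : A → Bool) xs ys → countB p (xs ++ ys) ≡ countB p xs ℕ.+ countB p ys
countB-++ p []       ys = refl
countB-++ p (x ∷ xs) ys with p x
... | true  = cong suc (countB-++ p xs ys)
... | false = countB-++ p xs ys

countB-map : ∀ {A B : Set} (p : B → Bool) (g : A → B) xs → countB p (map g xs) ≡ countB (p ∘ g) xs
countB-map p g []       = refl
countB-map p g (x ∷ xs) = cong (λ c → if p (g x) then suc c else c) (countB-map p g xs)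

countB-cong : ∀ {A : Set} {p q : A → Bool} → p ≗ q → ∀ xs → countB p xs ≡ countB q xs
countB-cong p≗q []       = refl
countB-cong p≗q (x ∷ xs) = cong₂ (λ b c → if b then suc c else c) (p≗q x) (countB-cong p≗q xs)

countB-none : ∀ {A : Set} {p : A → Bool} → (∀ x → p x ≡ false) → ∀ xs → countB p xs ≡ 0
countB-none p≡false []       = refl
countB-none p≡false (x ∷ xs) rewrite p≡false x = countB-none p≡false xs

withPart : ℕ → Series
withPart k j = + countB (noPartDiv25 ∘ (suc k ∷_)) (partsBounded (suc k) j)

R₂₅[≤suc] : ∀ k m → R₂₅[≤ suc k ] m ≡ R₂₅[≤ k ] m + shift (suc k) (withPart k) m
R₂₅[≤suc] k zero    = refl
R₂₅[≤suc] k (suc m) with suc k ≤? suc m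
... | yes (s≤s k≤m) = begin
    + countB P (partsBounded k (suc m) ++ map (suc k ∷_) ps)
  ≡⟨ cong +_ (countB-++ P (partsBounded k (suc m)) (map (suc k ∷_) ps)) ⟩
    + (countB P (partsBounded k (suc m)) ℕ.+ countB P (map (suc k ∷_) ps))
  ≡⟨ ℤ.pos-+ (countB P (partsBounded k (suc m))) _ ⟩
    R₂₅[≤ k ] (suc m) + + countB P (map (suc k ∷_) ps)
  ≡⟨ cong (λ c → R₂₅[≤ k ] (suc m) + + c) (countB-map P (suc k ∷_) ps) ⟩
    R₂₅[≤ k ] (suc m) + + countB (P ∘ (suc k ∷_)) ps
  ≡⟨ cong (λ qs → R₂₅[≤ k ] (suc m) + + countB (P ∘ (suc k ∷_)) qs)
          (partsAux-fuel (suc k) (m ∸ k) fuel-suffices ℕ.≤-refl) ⟩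
    R₂₅[≤ k ] (suc m) + withPart k (m ∸ k)
  ≡⟨ cong (λ x → R₂₅[≤ k ] (suc m) + x) (shift-≥ (suc k) (withPart k) (s≤s k≤m)) ⟨
    R₂₅[≤ k ] (suc m) + shift (suc k) (withPart k) (suc m)
  ∎
  where
  open ≡-Reasoning
  P  = noPartDiv25
  ps = partsAux (suc (k ℕ.+ suc m)) (suc k) (m ∸ k)
  fuel-suffices : suc k ℕ.+ (m ∸ k) < suc (k ℕ.+ suc m)
  fuel-suffices = s≤s (ℕ.≤-trans (ℕ.≤-reflexive (cong suc (ℕ.m+[n∸m]≡n k≤m))) (ℕ.m≤n+m (suc m) k))
... | no k≰m = begin
    + countB noPartDiv25 (partsBounded k (suc m) ++ [])
  ≡⟨ cong (λ ps → + countB noPartDiv25 ps) (++-identityʳ (partsBounded k (suc m))) ⟩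
    R₂₅[≤ k ] (suc m)
  ≡⟨ ℤ.+-identityʳ _ ⟨
    R₂₅[≤ k ] (suc m) + + 0
  ≡⟨ cong (λ x → R₂₅[≤ k ] (suc m) + x) (shift-< (suc k) (withPart k) (ℕ.≰⇒> k≰m)) ⟨
    R₂₅[≤ k ] (suc m) + shift (suc k) (withPart k) (suc m)
  ∎
  where open ≡-Reasoning

[1-q^]-R₂₅[≤suc] : ∀ k → ¬ 25 ℕ.∣ suc k → [1-q^ suc k ] R₂₅[≤ suc k ] ≗ R₂₅[≤ k ]
[1-q^]-R₂₅[≤suc] k 25∤ = [1-q^]-inverse (suc k) λ m →
  trans (R₂₅[≤suc] k m) (cong (λ x → R₂₅[≤ k ] m + x) (shift-cong (suc k) part-allowed m))
  where
  allowed : does (25 ℕ.∣? suc k) ≡ false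
  allowed = dec-false (25 ℕ.∣? suc k) 25∤
  part-allowed : withPart k ≗ R₂₅[≤ suc k ]
  part-allowed j = cong +_ (countB-cong (λ p → cong (λ b → not b ∧ noPartDiv25 p)
                                                    (trans (isYes≗does (25 ℕ.∣? suc k)) allowed))
                                        (partsBounded (suc k) j))

R₂₅[≤suc]-25∣ : ∀ k → 25 ℕ.∣ suc k → R₂₅[≤ suc k ] ≗ R₂₅[≤ k ]
R₂₅[≤suc]-25∣ k 25∣ m = begin
  R₂₅[≤ suc k ] m                              ≡⟨ R₂₅[≤suc] k m ⟩
  R₂₅[≤ k ] m + shift (suc k) (withPart k) m   ≡⟨ cong (λ x → R₂₅[≤ k ] m + x) (shift-cong (suc k) part-forbidden m) ⟩
  R₂₅[≤ k ] m + shift (suc k) (λ _ → + 0) m    ≡⟨ cong (λ x → R₂₅[≤ k ] m + x) (shift-const-0 (suc k) m) ⟩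
  R₂₅[≤ k ] m + + 0                            ≡⟨ ℤ.+-identityʳ _ ⟩
  R₂₅[≤ k ] m                                  ∎
  where
  open ≡-Reasoning
  forbidden : does (25 ℕ.∣? suc k) ≡ true
  forbidden = dec-true (25 ℕ.∣? suc k) 25∣
  part-forbidden : withPart k ≗ λ _ → + 0
  part-forbidden j = cong +_ (countB-none (λ p → cong (λ b → not b ∧ noPartDiv25 p)
                                                      (trans (isYes≗does (25 ℕ.∣? suc k)) forbidden))
                                          (partsBounded (suc k) j))

multiplesOf25 : ℕ → List ℕ
multiplesOf25 N = filter (25 ℕ.∣?_) (oneTo N)

multiplesOf25-skip : ∀ M j → j < 25 → multiplesOf25 (j ℕ.+ M ℕ.* 25) ≡ multiplesOf25 (M ℕ.* 25)
multiplesOf25-skip M zero    _    = refl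
multiplesOf25-skip M (suc j) j<25 =
  trans (filter-reject (25 ℕ.∣?_) 25∤) (multiplesOf25-skip M j (ℕ.<-trans (ℕ.n<1+n j) j<25))
  where
  25∤ : ¬ 25 ℕ.∣ suc j ℕ.+ M ℕ.* 25
  25∤ 25∣ = ℕ.<⇒≱ j<25 (ℕ.∣⇒≤ (ℕ.∣m+n∣m⇒∣n (subst (25 ℕ.∣_) (ℕ.+-comm (suc j) (M ℕ.* 25)) 25∣) (ℕ.n∣m*n M)))

multiplesOf25-step : ∀ M → multiplesOf25 (suc M ℕ.* 25) ≡ suc M ℕ.* 25 ∷ multiplesOf25 (M ℕ.* 25)
multiplesOf25-step M =
  trans (filter-accept (25 ℕ.∣?_) (ℕ.∣m∣n⇒∣m+n ℕ.∣-refl (ℕ.n∣m*n M)))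
        (cong (suc M ℕ.* 25 ∷_) (multiplesOf25-skip M 24 ℕ.≤-refl))

Π[1-q^]-multiplesOf25-truncate : ∀ j {n f} → Π[1-q^ multiplesOf25 (j ℕ.+ n) ] f ≈[ n ] Π[1-q^ multiplesOf25 n ] f
Π[1-q^]-multiplesOf25-truncate zero            = λ _ → [mod]-refl
Π[1-q^]-multiplesOf25-truncate (suc j) {n} {f} with 25 ℕ.∣? suc (j ℕ.+ n)
... | yes 25∣ = begin
    Π[1-q^ multiplesOf25 (suc j ℕ.+ n) ] f                    ≡⟨ cong (λ ms → Π[1-q^ ms ] f) (filter-accept (25 ℕ.∣?_) 25∣) ⟩
    [1-q^ suc (j ℕ.+ n) ] Π[1-q^ multiplesOf25 (j ℕ.+ n) ] f  ≈⟨ [1-q^]-large (suc (j ℕ.+ n)) (s≤s (ℕ.m≤n+m n j)) ⟩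
    Π[1-q^ multiplesOf25 (j ℕ.+ n) ] f                        ≈⟨ Π[1-q^]-multiplesOf25-truncate j ⟩
    Π[1-q^ multiplesOf25 n ] f                                ∎
  where open ≈-Reasoning n
... | no 25∤ = begin
    Π[1-q^ multiplesOf25 (suc j ℕ.+ n) ] f  ≡⟨ cong (λ ms → Π[1-q^ ms ] f) (filter-reject (25 ℕ.∣?_) 25∤) ⟩
    Π[1-q^ multiplesOf25 (j ℕ.+ n) ] f      ≈⟨ Π[1-q^]-multiplesOf25-truncate j ⟩
    Π[1-q^ multiplesOf25 n ] f              ∎
  where open ≈-Reasoning n

Π[1-q^]-oneTo-etaProd : ∀ N {n} → Π[1-q^ oneTo N ] etaProd N ≈[ n ] Π[1-q^ multiplesOf25 (N ℕ.* 25) ] oneS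
Π[1-q^]-oneTo-etaProd zero          = λ _ → [mod]-refl
Π[1-q^]-oneTo-etaProd (suc N) {n} = begin
    [1-q^ suc N ] Π[1-q^ oneTo N ] etaProd (suc N)
  ≈⟨ ≗⇒≈ ([1-q^]-cong (suc N) (Π[1-q^]-cong (oneTo N) (etaProd-suc N))) ⟩
    [1-q^ suc N ] Π[1-q^ oneTo N ] Π[1-q^ replicate 24 (suc N) ] etaProd N
  ≈⟨ ≗⇒≈ ([1-q^]-cong (suc N) (Π[1-q^]-comm (oneTo N) (replicate 24 (suc N)) (etaProd N))) ⟩
    Π[1-q^ replicate 25 (suc N) ] Π[1-q^ oneTo N ] etaProd N
  ≈⟨ Π[1-q^]-replicate-25 (suc N) (Π[1-q^ oneTo N ] etaProd N) ⟩
    [1-q^ suc N ℕ.* 25 ] Π[1-q^ oneTo N ] etaProd N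
  ≈⟨ [1-q^]-resp-≈ (suc N ℕ.* 25) (Π[1-q^]-oneTo-etaProd N) ⟩
    [1-q^ suc N ℕ.* 25 ] Π[1-q^ multiplesOf25 (N ℕ.* 25) ] oneS
  ≡⟨ cong (λ ms → Π[1-q^ ms ] oneS) (multiplesOf25-step N) ⟨
    Π[1-q^ multiplesOf25 (suc N ℕ.* 25) ] oneS
  ∎
  where open ≈-Reasoning n

Π[1-q^]-oneTo-R₂₅[≤] : ∀ N → Π[1-q^ oneTo N ] R₂₅[≤ N ] ≗ Π[1-q^ multiplesOf25 N ] oneS
Π[1-q^]-oneTo-R₂₅[≤] zero    = λ { zero → refl ; (suc _) → refl }
Π[1-q^]-oneTo-R₂₅[≤] (suc N) with 25 ℕ.∣? suc N
... | yes 25∣ = begin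
    [1-q^ suc N ] Π[1-q^ oneTo N ] R₂₅[≤ suc N ]   ≈⟨ [1-q^]-cong (suc N) (Π[1-q^]-cong (oneTo N) (R₂₅[≤suc]-25∣ N 25∣)) ⟩
    [1-q^ suc N ] Π[1-q^ oneTo N ] R₂₅[≤ N ]       ≈⟨ [1-q^]-cong (suc N) (Π[1-q^]-oneTo-R₂₅[≤] N) ⟩
    [1-q^ suc N ] Π[1-q^ multiplesOf25 N ] oneS    ≡⟨ cong (λ ms → Π[1-q^ ms ] oneS) (filter-accept (25 ℕ.∣?_) 25∣) ⟨
    Π[1-q^ multiplesOf25 (suc N) ] oneS            ∎
  where open ≗-Reasoning
... | no 25∤ = begin
    [1-q^ suc N ] Π[1-q^ oneTo N ] R₂₅[≤ suc N ]   ≈⟨ Π[1-q^]-[1-q^] (oneTo N) (suc N) R₂₅[≤ suc N ] ⟨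
    Π[1-q^ oneTo N ] [1-q^ suc N ] R₂₅[≤ suc N ]   ≈⟨ Π[1-q^]-cong (oneTo N) ([1-q^]-R₂₅[≤suc] N 25∤) ⟩
    Π[1-q^ oneTo N ] R₂₅[≤ N ]                     ≈⟨ Π[1-q^]-oneTo-R₂₅[≤] N ⟩
    Π[1-q^ multiplesOf25 N ] oneS                  ≡⟨ cong (λ ms → Π[1-q^ ms ] oneS) (filter-reject (25 ℕ.∣?_) 25∤) ⟨
    Π[1-q^ multiplesOf25 (suc N) ] oneS            ∎
  where open ≗-Reasoning

etaProd≈R₂₅ : ∀ n → etaProd n ≈[ n ] R₂₅[≤ n ]
etaProd≈R₂₅ n = Π[1-q^]-oneTo-cancel n (begin
  Π[1-q^ oneTo n ] etaProd n                        ≈⟨ Π[1-q^]-oneTo-etaProd n ⟩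
  Π[1-q^ multiplesOf25 (n ℕ.* 25) ] oneS            ≡⟨ cong (λ N → Π[1-q^ multiplesOf25 N ] oneS) n*25≡n*24+n ⟩
  Π[1-q^ multiplesOf25 (n ℕ.* 24 ℕ.+ n) ] oneS      ≈⟨ Π[1-q^]-multiplesOf25-truncate (n ℕ.* 24) ⟩
  Π[1-q^ multiplesOf25 n ] oneS                     ≈⟨ ≗⇒≈ (Π[1-q^]-oneTo-R₂₅[≤] n) ⟨
  Π[1-q^ oneTo n ] R₂₅[≤ n ]                        ∎)
  where
  open ≈-Reasoning n
  n*25≡n*24+n : n ℕ.* 25 ≡ n ℕ.* 24 ℕ.+ n
  n*25≡n*24+n = trans (ℕ.*-suc n 24) (ℕ.+-comm n (n ℕ.* 24))

-- The congruence holds for n = 0 as well.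
mainTheorem10 : (n : ℕ) → n ≥ 1 → (+ 5) ∣ (τ (suc n) - + (R₂₅ n))
mainTheorem10 n _ = Signed.∣⇒∣ᵤ (_≡_[mod_].d∣a-b (etaProd≈R₂₅ n ℕ.≤-refl))
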